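{- Let $p\geq 3$ and $m\geq 1$ be integers and $r=\lceil\log_2(p-1)\rceil$. Then \[\mathrm{forb}(m,3,p\cdot I_2)\geq 2^m+m2^{m-1}+(p-1)\left(\binom{m}{2}-\binom{r+1}{2}\right)+(r-1)2^r+1.\]
   Context: An $s$-matrix is a matrix with entries in $\{0,1,\dots,s-1\}$; it is simple if it has no repeated columns. $|A|$ is the number of columns of $A$. $F\prec A$ means some submatrix of $A$ is a row and column permutation of $F$. $\mathrm{Avoid}(m,s,F)$ is the set of $m$-rowed simple $s$-matrices $A$ with $F\not\prec A$, and $\mathrm{forb}(m,s,F)=\max\{|A|: A\in\mathrm{Avoid}(m,s,F)\}$. $I_2$ is the $2\times2$ identity matrix and $p\cdot I_2$ the concatenation of $p$ copies of it. -}

module Defs where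

open import Data.Nat using (ℕ; _*_; _%_; _≟_)
open import Data.Fin using (Fin; toℕ; zero; suc)
open import Data.Product using (Σ; _×_; ∃-syntax)
open import Function.Definitions using (Injective)
open import Relation.Binary.PropositionalEquality using (_≡_)
open import Relation.Nullary using (yes; no)
open import Relation.Nullary.Decidable using (does)
open import Data.Bool using (if_then_else_)

Mat : ℕ → ℕ → ℕ → Set
Mat s k l = Fin k → Fin l → Fin s

Simple : ∀ {s m n} → Mat s m n → Set
Simple {m = m} {n = n} A = ∀ (j j' : Fin n) → (∀ (i : Fin m) → A i j ≡ A i j') → j ≡ j'

-- F ≺ A: some submatrix of A is a row and column permutation of F, i.e.
-- there are injective maps of rows and columns of F into those of A
-- under which the entries agree.
_≺_ : ∀ {s k l m n} → Mat s k l → Mat s m n → Set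
_≺_ {k = k} {l} {m} {n} F A =
  Σ (Fin k → Fin m) λ f → Σ (Fin l → Fin n) λ g →
    Injective _≡_ _≡_ f × Injective _≡_ _≡_ g × (∀ i j → A (f i) (g j) ≡ F i j)

InAvoid : ∀ {s k l} (m : ℕ) → Mat s k l → ∀ {n} → Mat s m n → Set
InAvoid m F A = Simple A × (F ≺ A → Data.Empty.⊥)
  where import Data.Empty

-- p · I₂ : the 2 × 2p 3-matrix, concatenation of p copies of I₂;
-- column j is the (j mod 2)-th column of I₂.
pI₂ : (p : ℕ) → Mat 3 2 (p * 2)
pI₂ p i j = if does (toℕ i ≟ (toℕ j % 2)) then suc zero else zero

{-# OPTIONS --safe #-}
-- A column has an inversion at rows i < j if it reads 1 in row i and 0 in row j. An embedded
-- p · I₂ supplies p distinct columns with a common inversion (at its two rows, whichever comes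
-- first), so a simple matrix with fewer than p columns per inversion avoids p · I₂. We take all
-- 2^m + m 2^(m-1) inversion-free columns and, for every i < j, up to T = p - 1 of the columns
-- {0,2}^i 1 2^(j-i-1) 0 {1,2}^(m-1-j), whose only inversion is (i, j). The s + 1 pairs leaving
-- s free entries contribute min(T, 2^s) columns each, and with r = ⌈log₂ T⌉ the total over
-- s < m - 1 is at least T (C(m,2) - C(r+1,2)) + (r - 1) 2^r + 1, with equality once m - 1 ≥ r.
module Submission where

open import Defs

module Construction where

  open import Data.Bool using (if_then_else_)
  open import Data.Empty using (⊥; ⊥-elim)
  open import Data.Fin using (Fin; zero; suc; toℕ; combine; remQuot)
  import Data.Fin.Properties as Finₚ
  open import Data.List using (List; []; _∷_; _++_; map; length; lookup; take; replicate)
  open import Data.List.Properties using (length-++; length-map; length-take; length-replicate; ∷-injective; ++-cancelˡ)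
  open import Data.List.Membership.Propositional using (_∈_)
  open import Data.List.Membership.Propositional.Properties using (∈-map⁻; ∈-++⁻; ∈-lookup)
  open import Data.List.Relation.Unary.All as All using (All)
  import Data.List.Relation.Unary.All.Properties as Allₚ
  import Data.List.Relation.Unary.AllPairs as AllPairs
  import Data.List.Relation.Unary.Any as Any
  open import Data.List.Relation.Unary.Any.Properties using (lookup-index)
  open import Data.List.Relation.Unary.Unique.Propositional using (Unique)
  import Data.List.Relation.Unary.Unique.Propositional.Properties as Unique
  open import Data.List.Relation.Binary.Disjoint.Propositional using (Disjoint)
  import Data.List.Relation.Binary.Sublist.Propositional as Sublist
  open import Data.List.Relation.Binary.Sublist.Propositional.Properties using (take-⊆)
  open import Data.Nat using (ℕ; zero; suc; _+_; _*_; _∸_; _^_; _⊓_; _≤_; _≰_; _<_; z≤n; s≤s; _%_; ⌈_/2⌉)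
  open import Data.Nat.Properties
  open import Data.Nat.Combinatorics using (_C_; nC1≡n; nCk+nC[k+1]≡[n+1]C[k+1])
  open import Data.Nat.Induction using (<-wellFounded)
  open import Data.Nat.Logarithm using (⌈log₂_⌉; ⌈log₂⌉-mono-≤; ⌈log₂2^n⌉≡n)
  open import Data.Nat.Logarithm.Core using (⌈log2⌉)
  open import Induction.WellFounded using (Acc; acc)
  open import Data.Nat.DivMod using ([m+kn]%n≡m%n)
  open import Data.Nat.Tactic.RingSolver using (solve-∀)
  open import Data.Product using (∃-syntax; _×_; _,_; proj₁; proj₂) renaming (map to map×)
  open import Data.Sum using (_⊎_; inj₁; inj₂)
  open import Function.Definitions using (Injective)
  open import Relation.Binary.Definitions using (Tri; tri<; tri≈; tri>)
  open import Relation.Binary.PropositionalEquality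
  open import Relation.Nullary using (¬_; does; yes; no; contradiction)

  pattern 0₃ = zero
  pattern 1₃ = suc zero
  pattern 2₃ = suc (suc zero)

  Column : Set
  Column = List (Fin 3)

  -- Positions past the end of a column read as 2, a symbol that never takes part in an inversion.
  _!_ : Column → ℕ → Fin 3
  []      ! _     = 2₃
  (x ∷ c) ! zero  = x
  (x ∷ c) ! suc i = c ! i

  data Inversion : Column → ℕ → ℕ → Set where
    here  : ∀ {c j} → c ! j ≡ 0₃ → Inversion (1₃ ∷ c) zero (suc j)
    there : ∀ {x c i j} → Inversion c i j → Inversion (x ∷ c) (suc i) (suc j)

  entries⇒Inversion : ∀ c {i j} → i < j → c ! i ≡ 1₃ → c ! j ≡ 0₃ → Inversion c i j
  entries⇒Inversion (1₃ ∷ c) {zero}  {suc j} _         refl c!j≡0 = here c!j≡0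
  entries⇒Inversion (x ∷ c)  {suc i} {suc j} (s≤s i<j) c!i≡1 c!j≡0 =
    there (entries⇒Inversion c i<j c!i≡1 c!j≡0)

  InversionFree : Column → Set
  InversionFree c = ∀ {i j} → ¬ Inversion c i j

  ∷-inversionFree : ∀ {x c} → x ≢ 1₃ → InversionFree c → InversionFree (x ∷ c)
  ∷-inversionFree x≢1 free (here _)    = x≢1 refl
  ∷-inversionFree x≢1 free (there inv) = free inv

  ZeroFree : Column → Set
  ZeroFree c = ∀ j → c ! j ≢ 0₃

  ∷-zeroFree : ∀ {x c} → x ≢ 0₃ → ZeroFree c → ZeroFree (x ∷ c)
  ∷-zeroFree x≢0 free zero    = x≢0
  ∷-zeroFree x≢0 free (suc j) = free j

  zeroFree⇒inversionFree : ∀ {c} → ZeroFree c → InversionFree c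
  zeroFree⇒inversionFree no0 (here {j = j} c!j≡0) = no0 (suc j) c!j≡0
  zeroFree⇒inversionFree no0 (there inv)  = zeroFree⇒inversionFree (λ j → no0 (suc j)) inv

  toMat : ∀ m (cs : List Column) → Mat 3 m (length cs)
  toMat m cs i j = lookup cs j ! toℕ i

  lookup-injective : ∀ {A : Set} {xs : List A} → Unique xs → Injective _≡_ _≡_ (lookup xs)
  lookup-injective (_    AllPairs.∷ _) {zero}  {zero}  _  = refl
  lookup-injective (x∉xs AllPairs.∷ _) {zero}  {suc j} eq = ⊥-elim (All.lookup x∉xs (∈-lookup j) eq)
  lookup-injective (x∉xs AllPairs.∷ _) {suc i} {zero}  eq = ⊥-elim (All.lookup x∉xs (∈-lookup i) (sym eq))
  lookup-injective (_    AllPairs.∷ u) {suc i} {suc j} eq = cong suc (lookup-injective u eq)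

  ≡-by-entries : ∀ m {c c'} → length c ≡ m → length c' ≡ m →
    (∀ (i : Fin m) → c ! toℕ i ≡ c' ! toℕ i) → c ≡ c'
  ≡-by-entries zero    {[]}    {[]}     _  _   _  = refl
  ≡-by-entries (suc m) {x ∷ c} {x' ∷ c'} ∣c∣ ∣c'∣ eq =
    cong₂ _∷_ (eq zero) (≡-by-entries m (suc-injective ∣c∣) (suc-injective ∣c'∣) (λ i → eq (suc i)))

  toMat-simple : ∀ m {cs} → Unique cs → All (λ c → length c ≡ m) cs → Simple (toMat m cs)
  toMat-simple m {cs} u lengths j j' eq =
    lookup-injective u (≡-by-entries m (All.lookup lengths (∈-lookup j)) (All.lookup lengths (∈-lookup j')) eq)

  copy : ∀ {p} → Fin 2 → Fin p → Fin (p * 2)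
  copy j k = combine k j

  copy-injective : ∀ {p} j → Injective _≡_ _≡_ (copy {p} j)
  copy-injective j {k} {k'} eq =
    cong proj₁ (trans (sym (Finₚ.remQuot-combine k j)) (trans (cong (remQuot 2) eq) (Finₚ.remQuot-combine k' j)))

  toℕ-copy-%2 : ∀ {p} j (k : Fin p) → toℕ (copy j k) % 2 ≡ toℕ j
  toℕ-copy-%2 j k = begin
    toℕ (combine k j) % 2       ≡⟨ cong (_% 2) (Finₚ.toℕ-combine k j) ⟩
    (2 * toℕ k + toℕ j) % 2     ≡⟨ cong (_% 2) (+-comm (2 * toℕ k) (toℕ j)) ⟩
    (toℕ j + 2 * toℕ k) % 2     ≡⟨ cong (λ n → (toℕ j + n) % 2) (*-comm 2 (toℕ k)) ⟩
    (toℕ j + toℕ k * 2) % 2     ≡⟨ [m+kn]%n≡m%n (toℕ j) (toℕ k) 2 ⟩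
    toℕ j % 2                   ≡⟨ j%2 j ⟩
    toℕ j                       ∎
    where
    open ≡-Reasoning
    j%2 : ∀ (j : Fin 2) → toℕ j % 2 ≡ toℕ j
    j%2 zero       = refl
    j%2 (suc zero) = refl

  pI₂-copy : ∀ p i j (k : Fin p) → pI₂ p i (copy j k) ≡ (if does (toℕ i ≟ toℕ j) then 1₃ else 0₃)
  pI₂-copy p i j k = cong (λ n → if does (toℕ i ≟ n) then 1₃ else 0₃) (toℕ-copy-%2 j k)

  pI₂-free : ∀ {m n p} (A : Mat 3 m n) →
    (∀ {u v} → toℕ u < toℕ v → (g : Fin p → Fin n) → Injective _≡_ _≡_ g →
      (∀ k → A u (g k) ≡ 1₃) → (∀ k → A v (g k) ≡ 0₃) → ⊥) →
    ¬ (pI₂ p ≺ A)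
  pI₂-free {p = p} A few (f , g , f-injective , g-injective , embeds) =
    by-order (<-cmp (toℕ (f zero)) (toℕ (f (suc zero))))
    where
    entry : ∀ i j k → A (f i) (g (copy {p} j k)) ≡ (if does (toℕ i ≟ toℕ j) then 1₃ else 0₃)
    entry i j k = trans (embeds i (copy j k)) (pI₂-copy p i j k)

    copies : ∀ j → Injective _≡_ _≡_ (λ k → g (copy {p} j k))
    copies j eq = copy-injective j (g-injective eq)

    by-order : Tri (toℕ (f zero) < toℕ (f (suc zero))) _ _ → ⊥
    by-order (tri< u<v _ _) = few u<v _ (copies zero) (entry zero zero) (entry (suc zero) zero)
    by-order (tri> _ _ v<u) = few v<u _ (copies (suc zero)) (entry (suc zero) (suc zero)) (entry zero (suc zero))
    by-order (tri≈ _ u≡v _) with f-injective (Finₚ.toℕ-injective u≡v)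
    ... | ()

  ∈-pigeonhole : ∀ {A : Set} {n} {xs : List A} → length xs < n → (f : Fin n → A) → (∀ k → f k ∈ xs) →
    ¬ Injective _≡_ _≡_ f
  ∈-pigeonhole {xs = xs} ∣xs∣<n f f∈xs f-injective with Finₚ.pigeonhole ∣xs∣<n (λ k → Any.index (f∈xs k))
  ... | k , k' , k<k' , same-index = Finₚ.<⇒≢ k<k' (f-injective (begin
    f k                             ≡⟨ lookup-index (f∈xs k) ⟩
    lookup xs (Any.index (f∈xs k))  ≡⟨ cong (lookup xs) same-index ⟩
    lookup xs (Any.index (f∈xs k')) ≡⟨ lookup-index (f∈xs k') ⟨
    f k'                            ∎))
    where open ≡-Reasoning

  toMat-pI₂-free : ∀ m p {cs} → Unique cs →
    (block : ℕ → ℕ → List Column) → (∀ i j → length (block i j) < p) →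
    (∀ {c i j} → c ∈ cs → Inversion c i j → c ∈ block i j) →
    ¬ (pI₂ p ≺ toMat m cs)
  toMat-pI₂-free m p {cs} unique block small located = pI₂-free (toMat m cs) λ {u} {v} u<v g g-injective ones zeros →
    ∈-pigeonhole (small (toℕ u) (toℕ v)) (λ k → lookup cs (g k))
      (λ k → located (∈-lookup (g k)) (entries⇒Inversion _ u<v (ones k) (zeros k)))
      (λ eq → g-injective (lookup-injective unique eq))

  branch : Fin 3 → Fin 3 → List Column → List Column
  branch x y cs = map (x ∷_) cs ++ map (y ∷_) cs

  ∷-unique : ∀ {x : Fin 3} {cs : List Column} → Unique cs → Unique (map (x ∷_) cs)
  ∷-unique = Unique.map⁺ (λ eq → proj₂ (∷-injective eq))

  ∷-disjoint : ∀ {x y : Fin 3} {cs ds : List Column} → x ≢ y → Disjoint (map (x ∷_) cs) (map (y ∷_) ds)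
  ∷-disjoint x≢y (c∈xcs , c∈yds) with ∈-map⁻ _ c∈xcs | ∈-map⁻ _ c∈yds
  ... | _ , _ , refl | _ , _ , eq = x≢y (proj₁ (∷-injective eq))

  branch-unique : ∀ {x y cs} → x ≢ y → Unique cs → Unique (branch x y cs)
  branch-unique x≢y u = Unique.++⁺ (∷-unique u) (∷-unique u) (∷-disjoint x≢y)

  length-branch : ∀ x y cs → length (branch x y cs) ≡ 2 * length cs
  length-branch x y cs = begin
    length (map (x ∷_) cs ++ map (y ∷_) cs)        ≡⟨ length-++ (map (x ∷_) cs) ⟩
    length (map (x ∷_) cs) + length (map (y ∷_) cs) ≡⟨ cong₂ _+_ (length-map _ cs) (length-map _ cs) ⟩
    length cs + length cs                          ≡⟨ cong (length cs +_) (+-identityʳ (length cs)) ⟨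
    2 * length cs                                  ∎
    where open ≡-Reasoning

  branch-All⁺ : ∀ {P Q : Column → Set} {x y cs} → (∀ {c} → P c → Q (x ∷ c)) → (∀ {c} → P c → Q (y ∷ c)) →
    All P cs → All Q (branch x y cs)
  branch-All⁺ Px Py all = Allₚ.++⁺ (Allₚ.map⁺ (All.map Px all)) (Allₚ.map⁺ (All.map Py all))

  words₁₂ : ℕ → List Column
  words₁₂ zero    = [] ∷ []
  words₁₂ (suc k) = branch 1₃ 2₃ (words₁₂ k)

  words₁₂-unique : ∀ k → Unique (words₁₂ k)
  words₁₂-unique zero    = All.[] AllPairs.∷ AllPairs.[]
  words₁₂-unique (suc k) = branch-unique (λ ()) (words₁₂-unique k)

  length-words₁₂ : ∀ k → length (words₁₂ k) ≡ 2 ^ k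
  length-words₁₂ zero    = refl
  length-words₁₂ (suc k) = trans (length-branch 1₃ 2₃ (words₁₂ k)) (cong (2 *_) (length-words₁₂ k))

  words₁₂-lengths : ∀ k → All (λ c → length c ≡ k) (words₁₂ k)
  words₁₂-lengths zero    = refl All.∷ All.[]
  words₁₂-lengths (suc k) = branch-All⁺ (cong suc) (cong suc) (words₁₂-lengths k)

  words₁₂-zeroFree : ∀ k → All ZeroFree (words₁₂ k)
  words₁₂-zeroFree zero    = (λ _ ()) All.∷ All.[]
  words₁₂-zeroFree (suc k) = branch-All⁺ (∷-zeroFree λ ()) (∷-zeroFree λ ()) (words₁₂-zeroFree k)

  inversionFreeColumns : ℕ → List Column
  inversionFreeColumns zero    = [] ∷ []
  inversionFreeColumns (suc k) = branch 0₃ 2₃ (inversionFreeColumns k) ++ map (1₃ ∷_) (words₁₂ k)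

  inversionFreeColumns-unique : ∀ k → Unique (inversionFreeColumns k)
  inversionFreeColumns-unique zero    = All.[] AllPairs.∷ AllPairs.[]
  inversionFreeColumns-unique (suc k) =
    Unique.++⁺ (branch-unique (λ ()) (inversionFreeColumns-unique k)) (∷-unique (words₁₂-unique k)) disjoint
    where
    disjoint : Disjoint (branch 0₃ 2₃ (inversionFreeColumns k)) (map (1₃ ∷_) (words₁₂ k))
    disjoint (c∈branch , c∈1words) with ∈-++⁻ (map (0₃ ∷_) (inversionFreeColumns k)) c∈branch
    ... | inj₁ c∈0cs = ∷-disjoint (λ ()) (c∈0cs , c∈1words)
    ... | inj₂ c∈2cs = ∷-disjoint (λ ()) (c∈2cs , c∈1words)

  inversionFreeCount : ℕ → ℕ
  inversionFreeCount k = 2 ^ k + k * 2 ^ (k ∸ 1)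

  length-inversionFreeColumns : ∀ k → length (inversionFreeColumns k) ≡ inversionFreeCount k
  length-inversionFreeColumns zero    = refl
  length-inversionFreeColumns (suc k) = begin
    length (branch 0₃ 2₃ (inversionFreeColumns k) ++ map (1₃ ∷_) (words₁₂ k))
      ≡⟨ length-++ (branch 0₃ 2₃ (inversionFreeColumns k)) ⟩
    length (branch 0₃ 2₃ (inversionFreeColumns k)) + length (map (1₃ ∷_) (words₁₂ k))
      ≡⟨ cong₂ _+_ (length-branch 0₃ 2₃ (inversionFreeColumns k)) (length-map _ (words₁₂ k)) ⟩
    2 * length (inversionFreeColumns k) + length (words₁₂ k)
      ≡⟨ cong₂ (λ n w → 2 * n + w) (length-inversionFreeColumns k) (length-words₁₂ k) ⟩
    2 * inversionFreeCount k + 2 ^ k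
      ≡⟨ count k ⟩
    inversionFreeCount (suc k) ∎
    where
    open ≡-Reasoning
    count : ∀ k → 2 * inversionFreeCount k + 2 ^ k ≡ inversionFreeCount (suc k)
    count zero    = refl
    count (suc k) = doubling k (2 ^ k)
      where
      doubling : ∀ k x → 2 * (2 * x + suc k * x) + 2 * x ≡ 2 * (2 * x) + suc (suc k) * (2 * x)
      doubling = solve-∀

  inversionFreeColumns-lengths : ∀ k → All (λ c → length c ≡ k) (inversionFreeColumns k)
  inversionFreeColumns-lengths zero    = refl All.∷ All.[]
  inversionFreeColumns-lengths (suc k) =
    Allₚ.++⁺ (branch-All⁺ (cong suc) (cong suc) (inversionFreeColumns-lengths k))
             (Allₚ.map⁺ (All.map (cong suc) (words₁₂-lengths k)))

  inversionFreeColumns-inversionFree : ∀ k → All InversionFree (inversionFreeColumns k)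
  inversionFreeColumns-inversionFree zero    = (λ ()) All.∷ All.[]
  inversionFreeColumns-inversionFree (suc k) =
    Allₚ.++⁺ (branch-All⁺ (∷-inversionFree λ ()) (∷-inversionFree λ ()) (inversionFreeColumns-inversionFree k))
             (Allₚ.map⁺ (All.map 1∷-inversionFree (words₁₂-zeroFree k)))
    where
    1∷-inversionFree : ∀ {c} → ZeroFree c → InversionFree (1₃ ∷ c)
    1∷-inversionFree free = zeroFree⇒inversionFree (∷-zeroFree (λ ()) free)

  UniqueInversion : Column → ℕ → ℕ → Set
  UniqueInversion c i j = Inversion c i j × (∀ {i' j'} → Inversion c i' j' → i' ≡ i × j' ≡ j)

  ∷-uniqueInversion : ∀ {x c i j} → x ≢ 1₃ → UniqueInversion c i j → UniqueInversion (x ∷ c) (suc i) (suc j)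
  ∷-uniqueInversion x≢1 (inv , unique) = there inv , λ where
    (here _)     → ⊥-elim (x≢1 refl)
    (there inv') → map× (cong suc) (cong suc) (unique inv')

  gap : ℕ → Column → Column
  gap d v = replicate d 2₃ ++ 0₃ ∷ v

  gap-zero : ∀ d v → gap d v ! d ≡ 0₃
  gap-zero zero    v = refl
  gap-zero (suc d) v = gap-zero d v

  gap-zero-unique : ∀ d {v j} → ZeroFree v → gap d v ! j ≡ 0₃ → j ≡ d
  gap-zero-unique zero    {j = zero}  free _   = refl
  gap-zero-unique zero    {j = suc j} free v!j≡0 = ⊥-elim (free j v!j≡0)
  gap-zero-unique (suc d) {j = suc j} free e = cong suc (gap-zero-unique d free e)

  gap-inversionFree : ∀ d {v} → ZeroFree v → InversionFree (gap d v)
  gap-inversionFree zero    free = ∷-inversionFree (λ ()) (zeroFree⇒inversionFree free)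
  gap-inversionFree (suc d) free = ∷-inversionFree (λ ()) (gap-inversionFree d free)

  1∷gap-uniqueInversion : ∀ d {v} → ZeroFree v → UniqueInversion (1₃ ∷ gap d v) zero (suc d)
  1∷gap-uniqueInversion d free = here (gap-zero d _) , λ where
    (here v!j≡0) → refl , cong suc (gap-zero-unique d free v!j≡0)
    (there inv)  → ⊥-elim (gap-inversionFree d free inv)

  length-gap : ∀ d v → length (gap d v) ≡ d + suc (length v)
  length-gap d v = trans (length-++ (replicate d 2₃)) (cong (_+ suc (length v)) (length-replicate d))

  -- {0,2}^a 1 2^d 0 {1,2}^b
  singleInversion : ℕ → ℕ → ℕ → List Column
  singleInversion zero    d b = map (λ v → 1₃ ∷ gap d v) (words₁₂ b)
  singleInversion (suc a) d b = branch 0₃ 2₃ (singleInversion a d b)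

  singleInversion-unique : ∀ a d b → Unique (singleInversion a d b)
  singleInversion-unique zero    d b = Unique.map⁺ 1∷gap-injective (words₁₂-unique b)
    where
    1∷gap-injective : ∀ {v w} → 1₃ ∷ gap d v ≡ 1₃ ∷ gap d w → v ≡ w
    1∷gap-injective eq = proj₂ (∷-injective (++-cancelˡ (replicate d 2₃) _ _ (proj₂ (∷-injective eq))))
  singleInversion-unique (suc a) d b = branch-unique (λ ()) (singleInversion-unique a d b)

  length-singleInversion : ∀ a d b → length (singleInversion a d b) ≡ 2 ^ (a + b)
  length-singleInversion zero    d b = trans (length-map _ (words₁₂ b)) (length-words₁₂ b)
  length-singleInversion (suc a) d b =
    trans (length-branch 0₃ 2₃ (singleInversion a d b)) (cong (2 *_) (length-singleInversion a d b))

  singleInversion-lengths : ∀ a d b → All (λ c → length c ≡ a + suc (d + suc b)) (singleInversion a d b)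
  singleInversion-lengths zero    d b =
    Allₚ.map⁺ (All.map (λ {v} ∣v∣≡b → cong suc (trans (length-gap d v) (cong (λ n → d + suc n) ∣v∣≡b)))
                       (words₁₂-lengths b))
  singleInversion-lengths (suc a) d b = branch-All⁺ (cong suc) (cong suc) (singleInversion-lengths a d b)

  singleInversion-uniqueInversion : ∀ a d b → All (λ c → UniqueInversion c a (a + suc d)) (singleInversion a d b)
  singleInversion-uniqueInversion zero    d b =
    Allₚ.map⁺ (All.map (1∷gap-uniqueInversion d) (words₁₂-zeroFree b))
  singleInversion-uniqueInversion (suc a) d b =
    branch-All⁺ (∷-uniqueInversion λ ()) (∷-uniqueInversion λ ()) (singleInversion-uniqueInversion a d b)

  cap : ℕ → ℕ → ℕ
  cap T s = T ⊓ 2 ^ s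

  weightedSum : (ℕ → ℕ) → ℕ → ℕ
  weightedSum f zero    = 0
  weightedSum f (suc n) = weightedSum f n + suc n * f n

  module CappedBlocks (T : ℕ) where

    block : ℕ → ℕ → ℕ → List Column
    block a d b = take T (singleInversion a d b)

    ∈-block⁻ : ∀ a d b {c} → c ∈ block a d b → c ∈ singleInversion a d b
    ∈-block⁻ a d b = Sublist.lookup (take-⊆ T (singleInversion a d b))

    -- Blocks are grouped by the gap d and by the number a + b of free entries, on which their size depends.
    block-uniqueInversion : ∀ a d b {c} → c ∈ block a d b → UniqueInversion c a (a + suc d)
    block-uniqueInversion a d b c∈ = All.lookup (singleInversion-uniqueInversion a d b) (∈-block⁻ a d b c∈)

    block-shape : ∀ a d b a' d' b' {c} → c ∈ block a d b → c ∈ block a' d' b' → a ≡ a' × d ≡ d'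
    block-shape a d b a' d' b' c∈ c∈' with block-uniqueInversion a d b c∈ | block-uniqueInversion a' d' b' c∈'
    ... | inv , _ | _ , unique' with unique' inv
    ...   | refl , a+1+d≡a+1+d' = refl , suc-injective (+-cancelˡ-≡ a _ _ a+1+d≡a+1+d')

    sameGap : ℕ → ℕ → ℕ → List Column
    sameGap zero    d b = block zero d b
    sameGap (suc a) d b = block (suc a) d b ++ sameGap a d (suc b)

    extra : ℕ → ℕ → List Column
    extra zero    d = []
    extra (suc g) d = sameGap g d 0 ++ extra g (suc d)

    ∈-sameGap⁻ : ∀ a d b {c} → c ∈ sameGap a d b →
      ∃[ a' ] ∃[ b' ] a' ≤ a × a' + b' ≡ a + b × c ∈ block a' d b'
    ∈-sameGap⁻ zero    d b c∈ = zero , b , z≤n , refl , c∈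
    ∈-sameGap⁻ (suc a) d b c∈ with ∈-++⁻ (block (suc a) d b) c∈
    ... | inj₁ c∈block = suc a , b , ≤-refl , refl , c∈block
    ... | inj₂ c∈rest with ∈-sameGap⁻ a d (suc b) c∈rest
    ...   | a' , b' , a'≤a , sum , c∈block = a' , b' , m≤n⇒m≤1+n a'≤a , trans sum (+-suc a b) , c∈block

    ∈-extra⁻ : ∀ g d {c} → c ∈ extra g d →
      ∃[ a ] ∃[ d' ] ∃[ b ] d ≤ d' × suc (a + b + d') ≡ g + d × c ∈ block a d' b
    ∈-extra⁻ (suc g) d c∈ with ∈-++⁻ (sameGap g d 0) c∈
    ... | inj₁ c∈gap with ∈-sameGap⁻ g d 0 c∈gap
    ...   | a , b , _ , sum , c∈block =
      a , d , b , ≤-refl , cong (λ n → suc (n + d)) (trans sum (+-identityʳ g)) , c∈block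
    ∈-extra⁻ (suc g) d c∈ | inj₂ c∈rest with ∈-extra⁻ g (suc d) c∈rest
    ...   | a , d' , b , d<d' , sum , c∈block = a , d' , b , <⇒≤ d<d' , trans sum (+-suc g d) , c∈block

    sameGap-unique : ∀ a d b → Unique (sameGap a d b)
    sameGap-unique zero    d b = Unique.take⁺ T (singleInversion-unique zero d b)
    sameGap-unique (suc a) d b =
      Unique.++⁺ (Unique.take⁺ T (singleInversion-unique (suc a) d b)) (sameGap-unique a d (suc b)) disjoint
      where
      disjoint : Disjoint (block (suc a) d b) (sameGap a d (suc b))
      disjoint (c∈block , c∈rest) with ∈-sameGap⁻ a d (suc b) c∈rest
      ... | a' , b' , a'≤a , _ , c∈block' with block-shape (suc a) d b a' d b' c∈block c∈block'
      ...   | refl , _ = 1+n≰n a'≤a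

    extra-unique : ∀ g d → Unique (extra g d)
    extra-unique zero    d = AllPairs.[]
    extra-unique (suc g) d = Unique.++⁺ (sameGap-unique g d 0) (extra-unique g (suc d)) disjoint
      where
      disjoint : Disjoint (sameGap g d 0) (extra g (suc d))
      disjoint (c∈gap , c∈rest) with ∈-sameGap⁻ g d 0 c∈gap | ∈-extra⁻ g (suc d) c∈rest
      ... | a , b , _ , _ , c∈block | a' , d' , b' , d<d' , _ , c∈block'
        with block-shape a d b a' d' b' c∈block c∈block'
      ...   | _ , refl = 1+n≰n d<d'

    extra-not-inversionFree : ∀ g d {c} → c ∈ extra g d → ¬ InversionFree c
    extra-not-inversionFree g d c∈ free with ∈-extra⁻ g d c∈
    ... | a , d' , b , _ , _ , c∈block = free (proj₁ (block-uniqueInversion a d' b c∈block))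

    length-block : ∀ a d b → length (block a d b) ≡ T ⊓ 2 ^ (a + b)
    length-block a d b = trans (length-take T (singleInversion a d b)) (cong (T ⊓_) (length-singleInversion a d b))

    length-sameGap : ∀ a d b → length (sameGap a d b) ≡ suc a * (T ⊓ 2 ^ (a + b))
    length-sameGap zero    d b = trans (length-block zero d b) (sym (+-identityʳ _))
    length-sameGap (suc a) d b = begin
      length (block (suc a) d b ++ sameGap a d (suc b))
        ≡⟨ length-++ (block (suc a) d b) ⟩
      length (block (suc a) d b) + length (sameGap a d (suc b))
        ≡⟨ cong₂ _+_ (length-block (suc a) d b) (length-sameGap a d (suc b)) ⟩
      T ⊓ 2 ^ (suc a + b) + suc a * (T ⊓ 2 ^ (a + suc b))
        ≡⟨ cong (λ n → T ⊓ 2 ^ (suc a + b) + suc a * (T ⊓ 2 ^ n)) (+-suc a b) ⟩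
      suc (suc a) * (T ⊓ 2 ^ (suc a + b)) ∎
      where open ≡-Reasoning

    length-extra : ∀ g d → length (extra g d) ≡ weightedSum (cap T) g
    length-extra zero    d = refl
    length-extra (suc g) d = begin
      length (sameGap g d 0 ++ extra g (suc d))
        ≡⟨ length-++ (sameGap g d 0) ⟩
      length (sameGap g d 0) + length (extra g (suc d))
        ≡⟨ cong₂ _+_ (length-sameGap g d 0) (length-extra g (suc d)) ⟩
      suc g * (T ⊓ 2 ^ (g + 0)) + weightedSum (cap T) g
        ≡⟨ cong (λ n → suc g * (T ⊓ 2 ^ n) + weightedSum (cap T) g) (+-identityʳ g) ⟩
      suc g * (T ⊓ 2 ^ g) + weightedSum (cap T) g
        ≡⟨ +-comm _ (weightedSum (cap T) g) ⟩
      weightedSum (cap T) (suc g) ∎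
      where open ≡-Reasoning

    extra-length : ∀ g {c} → c ∈ extra g 0 → length c ≡ suc g
    extra-length g {c} c∈ with ∈-extra⁻ g 0 c∈
    ... | a , d , b , _ , sum , c∈block = begin
      length c               ≡⟨ All.lookup (singleInversion-lengths a d b) (∈-block⁻ a d b c∈block) ⟩
      a + suc (d + suc b)    ≡⟨ regroup a d b ⟩
      suc (suc (a + b + d))  ≡⟨ cong suc (trans sum (+-identityʳ g)) ⟩
      suc g                  ∎
      where
      open ≡-Reasoning
      regroup : ∀ a d b → a + suc (d + suc b) ≡ suc (suc (a + b + d))
      regroup = solve-∀

    extra-located : ∀ g {c i j} → c ∈ extra g 0 → Inversion c i j → c ∈ block i (j ∸ suc i) (g ∸ j)
    extra-located g {c} c∈ inv with ∈-extra⁻ g 0 c∈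
    ... | a , d , b , _ , sum , c∈block with proj₂ (block-uniqueInversion a d b c∈block) inv
    ...   | refl , refl = subst₂ (λ d' b' → c ∈ block a d' b') (sym gap-width) (sym suffix) c∈block
      where
      open ≡-Reasoning
      gap-width : a + suc d ∸ suc a ≡ d
      gap-width = trans (cong (_∸ suc a) (+-suc a d)) (m+n∸m≡n (suc a) d)
      suffix : g ∸ (a + suc d) ≡ b
      suffix = begin
        g ∸ (a + suc d)             ≡⟨ cong (_∸ (a + suc d)) (trans (sym (+-identityʳ g)) (sym sum)) ⟩
        suc (a + b + d) ∸ (a + suc d) ≡⟨ cong (_∸ (a + suc d)) (swap a d b) ⟩
        a + suc d + b ∸ (a + suc d)   ≡⟨ m+n∸m≡n (a + suc d) b ⟩
        b                           ∎
        where
        swap : ∀ a d b → suc (a + b + d) ≡ a + suc d + b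
        swap = solve-∀

  weightedSum-cong : ∀ {f h} n → (∀ s → s < n → f s ≡ h s) → weightedSum f n ≡ weightedSum h n
  weightedSum-cong zero    f≡h = refl
  weightedSum-cong (suc n) f≡h =
    cong₂ (λ x y → x + suc n * y) (weightedSum-cong n (λ s s<n → f≡h s (m≤n⇒m≤1+n s<n))) (f≡h n ≤-refl)

  weightedSum-exchange : ∀ {f h n m} → n ≤ m → (∀ s → n ≤ s → s < m → f s ≤ h s) →
    weightedSum f m + weightedSum h n ≤ weightedSum f n + weightedSum h m
  weightedSum-exchange {f} {h} {n} {m} n≤m f≤h with m≤n⇒m<n∨m≡n n≤m
  ... | inj₂ refl = ≤-refl
  ... | inj₁ n<m@(s≤s {n = m'} n≤m') = begin
    (weightedSum f m' + suc m' * f m') + weightedSum h n   ≡⟨ swap (weightedSum f m') _ _ ⟩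
    (weightedSum f m' + weightedSum h n) + suc m' * f m'
      ≤⟨ +-mono-≤ (weightedSum-exchange n≤m' (λ s n≤s s<m' → f≤h s n≤s (m≤n⇒m≤1+n s<m')))
                  (*-monoʳ-≤ (suc m') (f≤h m' n≤m' ≤-refl)) ⟩
    (weightedSum f n + weightedSum h m') + suc m' * h m'   ≡⟨ +-assoc (weightedSum f n) _ _ ⟩
    weightedSum f n + (weightedSum h m' + suc m' * h m')   ∎
    where
    open ≤-Reasoning
    swap : ∀ x y z → (x + y) + z ≡ (x + z) + y
    swap = solve-∀

  weightedSum-const : ∀ k n → weightedSum (λ _ → k) n ≡ k * (suc n C 2)
  weightedSum-const k zero    = sym (*-zeroʳ k)
  weightedSum-const k (suc n) = begin
    weightedSum (λ _ → k) n + suc n * k        ≡⟨ cong₂ _+_ (weightedSum-const k n) (*-comm (suc n) k) ⟩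
    k * (suc n C 2) + k * suc n                ≡⟨ *-distribˡ-+ k (suc n C 2) (suc n) ⟨
    k * (suc n C 2 + suc n)                    ≡⟨ cong (λ x → k * (suc n C 2 + x)) (nC1≡n (suc n)) ⟨
    k * (suc n C 2 + suc n C 1)                ≡⟨ cong (k *_) (+-comm (suc n C 2) _) ⟩
    k * (suc n C 1 + suc n C 2)                ≡⟨ cong (k *_) (nCk+nC[k+1]≡[n+1]C[k+1] (suc n) 1) ⟩
    k * (suc (suc n) C 2)                      ∎
    where open ≡-Reasoning

  weightedSum-pow2 : ∀ r → weightedSum (2 ^_) (suc r) ≡ r * 2 ^ suc r + 1
  weightedSum-pow2 zero    = refl
  weightedSum-pow2 (suc r) = trans (cong (_+ suc (suc r) * 2 ^ suc r) (weightedSum-pow2 r)) (step r (2 ^ r))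
    where
    step : ∀ r x → (r * (2 * x) + 1) + suc (suc r) * (2 * x) ≡ suc r * (2 * (2 * x)) + 1
    step = solve-∀

  -- The cap T ⊓ 2 ^ s is 2 ^ s for s < r and T for s ≥ r; for K ≥ r the bound is an equality.
  capped-bound : ∀ T r K → (∀ s → s < r → 2 ^ s ≤ T) → T ≤ 2 ^ r →
    weightedSum (λ _ → T) K + weightedSum (2 ^_) r ≤ weightedSum (cap T) K + weightedSum (λ _ → T) r
  capped-bound T r K small large = begin
    weightedSum (λ _ → T) K + weightedSum (2 ^_) r
      ≡⟨ cong (weightedSum (λ _ → T) K +_) (weightedSum-cong r (λ s s<r → sym (m≥n⇒m⊓n≡n (small s s<r)))) ⟩
    weightedSum (λ _ → T) K + weightedSum (cap T) r
      ≤⟨ by-order (≤-total K r) ⟩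
    weightedSum (cap T) K + weightedSum (λ _ → T) r ∎
    where
    open ≤-Reasoning
    ≥-cap : ∀ s → r ≤ s → T ≤ cap T s
    ≥-cap s r≤s = ≤-reflexive (sym (m≤n⇒m⊓n≡m (≤-trans large (^-monoʳ-≤ 2 r≤s))))
    by-order : K ≤ r ⊎ r ≤ K →
      weightedSum (λ _ → T) K + weightedSum (cap T) r ≤ weightedSum (cap T) K + weightedSum (λ _ → T) r
    by-order (inj₁ K≤r) = ≤-trans (≤-reflexive (+-comm (weightedSum (λ _ → T) K) _))
                                  (weightedSum-exchange K≤r (λ s _ _ → m⊓n≤m T (2 ^ s)))
    by-order (inj₂ r≤K) = ≤-trans (weightedSum-exchange r≤K (λ s r≤s _ → ≥-cap s r≤s))
                                  (≤-reflexive (+-comm (weightedSum (λ _ → T) r) _))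

  n≤2^⌈log2⌉n : ∀ n (acc : Acc _<_ n) → n ≤ 2 ^ ⌈log2⌉ n acc
  n≤2^⌈log2⌉n zero                _        = z≤n
  n≤2^⌈log2⌉n (suc zero)          _        = s≤s z≤n
  n≤2^⌈log2⌉n (suc (suc n)) (acc rs) = begin
    suc (suc n)                     ≤⟨ s≤s (s≤s n≤⌈n/2⌉+⌈n/2⌉) ⟩
    suc (suc (⌈ n /2⌉ + ⌈ n /2⌉))    ≡⟨ cong suc (+-suc ⌈ n /2⌉ ⌈ n /2⌉) ⟨
    suc ⌈ n /2⌉ + suc ⌈ n /2⌉        ≡⟨ cong (suc ⌈ n /2⌉ +_) (+-identityʳ (suc ⌈ n /2⌉)) ⟨
    2 * suc ⌈ n /2⌉                  ≤⟨ *-monoʳ-≤ 2 (n≤2^⌈log2⌉n (suc ⌈ n /2⌉) _) ⟩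
    2 * 2 ^ ⌈log2⌉ (suc ⌈ n /2⌉) _   ∎
    where
    open ≤-Reasoning
    n≤⌈n/2⌉+⌈n/2⌉ : n ≤ ⌈ n /2⌉ + ⌈ n /2⌉
    n≤⌈n/2⌉+⌈n/2⌉ = ≤-trans (≤-reflexive (sym (⌊n/2⌋+⌈n/2⌉≡n n)))
                            (+-monoˡ-≤ ⌈ n /2⌉ (⌊n/2⌋≤⌈n/2⌉ n))

  n≤2^⌈log₂n⌉ : ∀ n → n ≤ 2 ^ ⌈log₂ n ⌉
  n≤2^⌈log₂n⌉ n = n≤2^⌈log2⌉n n (<-wellFounded n)

  1≤⌈log₂n⌉ : ∀ {n} → 2 ≤ n → 1 ≤ ⌈log₂ n ⌉
  1≤⌈log₂n⌉ 2≤n = ⌈log₂⌉-mono-≤ 2≤n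

  2^[⌈log₂n⌉∸1]<n : ∀ {n} → 2 ≤ n → 2 ^ (⌈log₂ n ⌉ ∸ 1) < n
  2^[⌈log₂n⌉∸1]<n {n} 2≤n with n ≤? 2 ^ (⌈log₂ n ⌉ ∸ 1)
  ... | no  n≰2^[r∸1] = ≰⇒> n≰2^[r∸1]
  ... | yes n≤2^[r∸1] = contradiction (begin
    ⌈log₂ n ⌉                     ≤⟨ ⌈log₂⌉-mono-≤ n≤2^[r∸1] ⟩
    ⌈log₂ 2 ^ (⌈log₂ n ⌉ ∸ 1) ⌉  ≡⟨ ⌈log₂2^n⌉≡n (⌈log₂ n ⌉ ∸ 1) ⟩
    ⌈log₂ n ⌉ ∸ 1                 ∎) (m≰m∸1 (1≤⌈log₂n⌉ 2≤n))
    where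
    open ≤-Reasoning
    m≰m∸1 : ∀ {m} → 1 ≤ m → m ≰ m ∸ 1
    m≰m∸1 {suc m} _ = 1+n≰n

  module _ (T K : ℕ) where
    open CappedBlocks T

    columns : List Column
    columns = inversionFreeColumns (suc K) ++ extra K 0

    length-columns : length columns ≡ inversionFreeCount (suc K) + weightedSum (cap T) K
    length-columns = trans (length-++ (inversionFreeColumns (suc K)))
                           (cong₂ _+_ (length-inversionFreeColumns (suc K)) (length-extra K 0))

    columns-avoid : InAvoid (suc K) (pI₂ (suc T)) (toMat (suc K) columns)
    columns-avoid = toMat-simple (suc K) unique lengths , toMat-pI₂-free (suc K) (suc T) unique blockAt small located
      where
      unique : Unique columns
      unique = Unique.++⁺ (inversionFreeColumns-unique (suc K)) (extra-unique K 0) λ (c∈free , c∈extra) →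
        extra-not-inversionFree K 0 c∈extra (All.lookup (inversionFreeColumns-inversionFree (suc K)) c∈free)

      lengths : All (λ c → length c ≡ suc K) columns
      lengths = Allₚ.++⁺ (inversionFreeColumns-lengths (suc K)) (All.tabulate (extra-length K))

      blockAt : ℕ → ℕ → List Column
      blockAt i j = block i (j ∸ suc i) (K ∸ j)

      small : ∀ i j → length (blockAt i j) < suc T
      small i j = s≤s (≤-trans (≤-reflexive (length-take T _)) (m⊓n≤m T _))

      located : ∀ {c i j} → c ∈ columns → Inversion c i j → c ∈ blockAt i j
      located c∈ inv with ∈-++⁻ (inversionFreeColumns (suc K)) c∈
      ... | inj₁ c∈free  = ⊥-elim (All.lookup (inversionFreeColumns-inversionFree (suc K)) c∈free inv)
      ... | inj₂ c∈extra = extra-located K c∈extra inv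

    extra-count-bound : 2 ≤ T →
      T * (suc K C 2) + ((⌈log₂ T ⌉ ∸ 1) * 2 ^ ⌈log₂ T ⌉ + 1) ≤
      weightedSum (cap T) K + T * ((⌈log₂ T ⌉ + 1) C 2)
    extra-count-bound 2≤T with ⌈log₂ T ⌉ | 1≤⌈log₂n⌉ 2≤T | n≤2^⌈log₂n⌉ T | 2^[⌈log₂n⌉∸1]<n 2≤T
    ... | suc R | _ | T≤2^r | 2^R<T = begin
      T * (suc K C 2) + (R * 2 ^ suc R + 1)
        ≡⟨ cong₂ _+_ (weightedSum-const T K) (weightedSum-pow2 R) ⟨
      weightedSum (λ _ → T) K + weightedSum (2 ^_) (suc R)
        ≤⟨ capped-bound T (suc R) K below T≤2^r ⟩
      weightedSum (cap T) K + weightedSum (λ _ → T) (suc R)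
        ≡⟨ cong (weightedSum (cap T) K +_) (weightedSum-const T (suc R)) ⟩
      weightedSum (cap T) K + T * (suc (suc R) C 2)
        ≡⟨ cong (λ n → weightedSum (cap T) K + T * (n C 2)) (+-comm 1 (suc R)) ⟩
      weightedSum (cap T) K + T * ((suc R + 1) C 2) ∎
      where
      open ≤-Reasoning
      below : ∀ s → s < suc R → 2 ^ s ≤ T
      below s (s≤s s≤R) = <⇒≤ (≤-<-trans (^-monoʳ-≤ 2 s≤R) 2^R<T)

open Construction
  using (columns; length-columns; columns-avoid; extra-count-bound; inversionFreeCount; toMat; weightedSum; cap; 1≤⌈log₂n⌉)
open import Data.Nat using (ℕ; _≤_; _∸_; _⊓_; zero; suc; s≤s)
open import Data.Nat.Combinatorics using (_C_)
open import Data.Nat.Logarithm using (⌈log₂_⌉)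
open import Data.Integer using (ℤ; +_; _+_; _-_; _*_; +≤+) renaming (_≤_ to _≤ℤ_)
open import Data.Integer.Properties using (pos-*; ⊖-≥; +-monoʳ-≤; module ≤-Reasoning)
open import Data.Integer.Tactic.RingSolver using (solve-∀)
open import Data.List using (length)
open import Data.Product using (Σ; _×_; _,_)
open import Relation.Binary.PropositionalEquality using (_≡_; cong; cong₂; subst₂; sym; trans)

rearrange-≤ : ∀ (a t x y q₁ q₂ e : ℤ) → t * x + (q₁ + q₂) ≤ℤ e + t * y →
  a + t * (x - y) + q₁ + q₂ ≤ℤ a + e
rearrange-≤ a t x y q₁ q₂ e hyp = begin
  a + t * (x - y) + q₁ + q₂           ≡⟨ regroup a t x y q₁ q₂ ⟩
  (a - t * y) + (t * x + (q₁ + q₂))   ≤⟨ +-monoʳ-≤ (a - t * y) hyp ⟩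
  (a - t * y) + (e + t * y)           ≡⟨ cancel a t y e ⟩
  a + e                               ∎
  where
  open ≤-Reasoning
  regroup : ∀ a t x y q₁ q₂ → a + t * (x - y) + q₁ + q₂ ≡ (a - t * y) + (t * x + (q₁ + q₂))
  regroup = solve-∀
  cancel : ∀ a t y e → (a - t * y) + (e + t * y) ≡ a + e
  cancel = solve-∀

columns-count-bound : ∀ T K → 2 ≤ T →
  (+ (2 Data.Nat.^ suc K)) + (+ suc K) * (+ (2 Data.Nat.^ K))
    + (+ T) * ((+ (suc K C 2)) - (+ ((⌈log₂ T ⌉ Data.Nat.+ 1) C 2)))
    + ((+ ⌈log₂ T ⌉) - (+ 1)) * (+ (2 Data.Nat.^ ⌈log₂ T ⌉))
    + (+ 1)
    ≤ℤ + length (columns T K)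
columns-count-bound T K 2≤T = begin
  _ ≤⟨ rearrange-≤ (+ (2 Data.Nat.^ suc K) + (+ suc K) * (+ (2 Data.Nat.^ K)))
                   (+ T) (+ (suc K C 2)) (+ ((r Data.Nat.+ 1) C 2))
                   ((+ r - + 1) * + (2 Data.Nat.^ r)) (+ 1) (+ E) extra-count-bound-ℤ ⟩
  + (2 Data.Nat.^ suc K) + (+ suc K) * (+ (2 Data.Nat.^ K)) + + E
    ≡⟨ cong (λ u → + (2 Data.Nat.^ suc K) + u + + E) (sym (pos-* (suc K) (2 Data.Nat.^ K))) ⟩
  + (inversionFreeCount (suc K) Data.Nat.+ E)
    ≡⟨ cong +_ (sym (length-columns T K)) ⟩
  + length (columns T K)                     ∎
  where
  open ≤-Reasoning
  r : ℕ
  r = ⌈log₂ T ⌉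
  E : ℕ
  E = weightedSum (cap T) K
  extra-count-bound-ℤ : + T * + (suc K C 2) + ((+ r - + 1) * + (2 Data.Nat.^ r) + + 1) ≤ℤ
                        + E + + T * + ((r Data.Nat.+ 1) C 2)
  extra-count-bound-ℤ = subst₂ _≤ℤ_
    (cong₂ (λ u v → u + (v + + 1)) (pos-* T (suc K C 2))
      (trans (pos-* (r ∸ 1) (2 Data.Nat.^ r)) (cong (_* + (2 Data.Nat.^ r)) (sym (⊖-≥ (1≤⌈log₂n⌉ 2≤T))))))
    (cong (_+_ (+ E)) (pos-* T ((r Data.Nat.+ 1) C 2)))
    (+≤+ (extra-count-bound T K 2≤T))

lemma3 : (p m : ℕ) → 3 ≤ p → 1 ≤ m →
    Σ ℕ λ n → Σ (Mat 3 m n) λ A → InAvoid m (pI₂ p) A ×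
      ((+ (2 Data.Nat.^ m)) + (+ m) * (+ (2 Data.Nat.^ (m ∸ 1)))
        + (+ (p ∸ 1)) * ((+ (m C 2)) - (+ ((⌈log₂ (p ∸ 1) ⌉ Data.Nat.+ 1) C 2)))
        + ((+ ⌈log₂ (p ∸ 1) ⌉) - (+ 1)) * (+ (2 Data.Nat.^ ⌈log₂ (p ∸ 1) ⌉))
        + (+ 1)
        ≤ℤ (+ n))
lemma3 zero    _       ()        _
lemma3 (suc T) zero    _         ()
lemma3 (suc T) (suc K) (s≤s 2≤T) _ =
  length (columns T K) , toMat (suc K) (columns T K) , columns-avoid T K , columns-count-bound T K 2≤T
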